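{- Let $(\mathbf f_1,\mathbf f_2)$ be a basis of $\mathbb{Z}^2$ and let $\mathbf v$, $\mathbf w$ be the endpoints of an integer slope with respect to $(\mathbf f_1,\mathbf f_2)$ having $N$ edges. Write $\mathbf w-\mathbf v=b_1\mathbf f_1+b_2\mathbf f_2$. Then there exists an integer $s$ such that $2N\le |b_1|+s$, $|b_2|\ge s(s+1)/2$ and $0\le s\le N$. If the vertices of the slope belong to a lattice whose small $\mathbf f_1$-step (with respect to $(\mathbf f_1,\mathbf f_2)$) is greater than $1$, one can take $s=0$, so that $2N\le|b_1|$. If the vertices of the slope belong to a lattice having the basis $(\mathbf f_1-a\mathbf f_2,\, m\mathbf f_2)$ with integers $1\le a\le m$, then the inequality $|b_2|\ge s(s+1)/2$ can be replaced by $|b_2|\ge \frac{2a+(s-1)m}{2}\,s$.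
   Context: Let $(\mathbf f_1,\mathbf f_2)$ be a basis of $\mathbb{R}^2$ and $\mathbf v_0,\dots,\mathbf v_N$ ($N\ge0$) points of the plane; put $\mathbf a_i=\mathbf v_i-\mathbf v_{i-1}=a_{i1}\mathbf f_1+a_{i2}\mathbf f_2$. If $a_{i1}>0$, $a_{i2}<0$ for $i=1,\dots,N$ and $a_{i1}a_{i+1,2}-a_{i+1,1}a_{i2}>0$ for $i=1,\dots,N-1$, the union of the segments $[\mathbf v_{i-1},\mathbf v_i]$ (a single point if $N=0$) is a slope with respect to $(\mathbf f_1,\mathbf f_2)$, with edges $[\mathbf v_{i-1},\mathbf v_i]$, vertices $\mathbf v_i$ and endpoints $\mathbf v_0,\mathbf v_N$. It is an integer slope if all vertices lie in $\mathbb{Z}^2$. A lattice is a subgroup $A\mathbb{Z}^2$ of $\mathbb{Z}^2$ with $\det A\ne0$. For such a lattice $\Lambda$ and a basis $(\mathbf f_1,\mathbf f_2)$ of $\mathbb{Z}^2$, the small $\mathbf f_1$-step of $\Lambda$ is the positive generator of the subgroup $\{u_1\in\mathbb{Z}:\exists u_2\in\mathbb{Z},\ u_1\mathbf f_1+u_2\mathbf f_2\in\Lambda\}$ of $\mathbb{Z}$. -}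

module Defs where

open import Data.Nat using (ℕ; suc)
open import Data.Integer using (ℤ; +_; _+_; _-_; _*_; _<_; _>_; 0ℤ; 1ℤ)
open import Data.Integer.Divisibility using (_∣_)
open import Data.Product using (_×_; _,_; Σ; ∃; ∃-syntax; proj₁; proj₂)
open import Relation.Binary.PropositionalEquality using (_≡_; _≢_)
open import Function.Bundles using (_⇔_)

V : Set
V = ℤ × ℤ

_⊕_ : V → V → V
(x₁ , x₂) ⊕ (y₁ , y₂) = (x₁ + y₁ , x₂ + y₂)

_⊖_ : V → V → V
(x₁ , x₂) ⊖ (y₁ , y₂) = (x₁ - y₁ , x₂ - y₂)

_·_ : ℤ → V → V
c · (x₁ , x₂) = (c * x₁ , c * x₂)

infixl 6 _⊕_ _⊖_
infixl 7 _·_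

lin : V → V → ℤ → ℤ → V
lin f₁ f₂ x y = x · f₁ ⊕ y · f₂

IsBasisℤ² : V → V → Set
IsBasisℤ² f₁ f₂ =
  (p : V) → Σ (ℤ × ℤ) λ c →
    (p ≡ lin f₁ f₂ (proj₁ c) (proj₂ c))
    × ((x y : ℤ) → p ≡ lin f₁ f₂ x y → (x ≡ proj₁ c) × (y ≡ proj₂ c))

-- Only v 0 … v N matter.
-- Vertices are in ℤ² by construction (integer slope).
IsIntegerSlope : V → V → (N : ℕ) → (ℕ → V) → Set
IsIntegerSlope f₁ f₂ N v =
  Σ (ℕ → ℤ × ℤ) λ a →
    ((i : ℕ) → 1 Data.Nat.≤ i → i Data.Nat.≤ N →
       (v i ⊖ v (i Data.Nat.∸ 1) ≡ lin f₁ f₂ (proj₁ (a i)) (proj₂ (a i)))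
       × (proj₁ (a i) > 0ℤ) × (proj₂ (a i) < 0ℤ))
    × ((i : ℕ) → 1 Data.Nat.≤ i → suc i Data.Nat.≤ N →
       proj₁ (a i) * proj₂ (a (suc i)) - proj₁ (a (suc i)) * proj₂ (a i) > 0ℤ)

det : V → V → ℤ
det (x₁ , x₂) (y₁ , y₂) = x₁ * y₂ - y₁ * x₂

InLattice : V → V → V → Set
InLattice c₁ c₂ p = ∃[ x ] ∃[ y ] (p ≡ lin c₁ c₂ x y)

IsSmallStep : V → V → V → V → ℤ → Set
IsSmallStep f₁ f₂ c₁ c₂ d =
  (d > 0ℤ) ×
  ((u₁ : ℤ) → (∃[ u₂ ] InLattice c₁ c₂ (lin f₁ f₂ u₁ u₂)) ⇔ (d ∣ u₁))

-- Write the edges of the slope as width·f₁ − height·f₂ with positive widths and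
-- heights; then b₁ and −b₂ are the sums of the widths and of the heights, and the
-- convexity condition says that the slopes height/width strictly decrease.  Take
-- s to be the number of edges of width 1.  Every other edge has width at least 2,
-- so 2N ≤ |b₁| + s.  The unit-width edges have pairwise distinct heights, and in
-- the lattice with basis (f₁ − a f₂, m f₂) these heights lie in a + mℕ, so the
-- heights of the s unit edges dominate a, a + m, …, a + (s − 1)m; summing gives
-- the bound on |b₂| (for the first claim take a = m = 1).  A small f₁-step d > 1 divides
-- every width, so no edge has width 1 and s = 0.

module Submission where

open import Defs
open import Data.Nat
open import Data.Nat.Properties
open import Data.Nat.Tactic.RingSolver using (solve)
open import Algebra.Properties.CommutativeSemigroup *-commutativeSemigroup using (x∙yz≈y∙xz)
import Data.Nat.Divisibility as ℕ
open import Data.Integer as ℤ using (ℤ; +_; -_; +0; +[1+_]; -[1+_]; ∣_∣; 0ℤ; 1ℤ; +<+)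
import Data.Integer.Properties as ℤₚ
open import Data.Integer.Divisibility using () renaming (_∣_ to _∣ℤ_)
open import Data.Integer.Tactic.RingSolver using (solve-∀)
open import Data.List using (_∷_; []; applyUpTo; applyDownFrom; filter; length)
open import Data.Nat.ListAction using (sum)
open import Data.List.Properties using (filter-accept; filter-reject; length-filter; length-applyUpTo)
open import Data.Product using (_×_; _,_; proj₁; proj₂; ∃-syntax)
open import Function using (_∘_)
open import Function.Bundles using (Equivalence)
open import Relation.Nullary using (¬_; yes; no; contradiction)
open import Relation.Binary.PropositionalEquality

private
  variable
    a m n t x c p₀ q₀ p₁ q₁ : ℕ
    i j i′ j′ d : ℤ
    p q : ℕ → ℕ
    v : ℕ → V
    f₁ f₂ c₁ c₂ u w : V

DecreasingSlopes : ℕ → (ℕ → ℕ) → (ℕ → ℕ) → Set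
DecreasingSlopes n p q = ∀ k → suc k < n → p k * q (suc k) < p (suc k) * q k

InProgression : ℕ → ℕ → ℕ → Set
InProgression a m x = ∃[ t ] x ≡ a + t * m

UnitHeightsIn : ℕ → ℕ → ℕ → (ℕ → ℕ) → (ℕ → ℕ) → Set
UnitHeightsIn a m n p q = ∀ k → k < n → p k ≡ 1 → InProgression a m (q k)

units : ℕ → (ℕ → ℕ) → ℕ
units n p = length (filter (_≟ 1) (applyUpTo p n))

units-accept : p 0 ≡ 1 → units (suc n) p ≡ suc (units n (p ∘ suc))
units-accept p₀≡1 = cong length (filter-accept (_≟ 1) p₀≡1)

units-reject : p 0 ≢ 1 → units (suc n) p ≡ units n (p ∘ suc)
units-reject p₀≢1 = cong length (filter-reject (_≟ 1) p₀≢1)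

units≤n : units n p ≤ n
units≤n {n} {p} = ≤-trans (length-filter (_≟ 1) (applyUpTo p n)) (≤-reflexive (length-applyUpTo p n))

units≡0 : (∀ k → k < n → p k ≢ 1) → units n p ≡ 0
units≡0 {zero}  _      = refl
units≡0 {suc n} {p} noUnit =
  trans (units-reject {p = p} {n = n} (noUnit 0 z<s)) (units≡0 λ k k<n → noUnit (suc k) (s≤s k<n))

widths-bound : (∀ k → k < n → 1 ≤ p k) → 2 * n ≤ sum (applyUpTo p n) + units n p
widths-bound {zero}  _   = z≤n
widths-bound {suc n} {p} pos with p 0 ≟ 1 | widths-bound {n} {p ∘ suc} (λ k k<n → pos (suc k) (s≤s k<n))
... | yes p₀≡1 | ih rewrite units-accept {p = p} {n = n} p₀≡1 | p₀≡1 = begin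
  2 * suc n                 ≡⟨ *-suc 2 n ⟩
  2 + 2 * n                 ≤⟨ +-monoʳ-≤ 2 ih ⟩
  2 + (P + U)               ≡⟨ cong suc (+-suc P U) ⟨
  1 + P + suc U             ∎
  where
  open ≤-Reasoning
  P U : ℕ
  P = sum (applyUpTo (p ∘ suc) n)
  U = units n (p ∘ suc)
... | no p₀≢1  | ih rewrite units-reject {p = p} {n = n} p₀≢1 = begin
  2 * suc n                 ≡⟨ *-suc 2 n ⟩
  2 + 2 * n                 ≤⟨ +-mono-≤ (≤∧≢⇒< (pos 0 z<s) (p₀≢1 ∘ sym)) ih ⟩
  p 0 + (P + U)             ≡⟨ +-assoc (p 0) P U ⟨
  p 0 + P + U               ∎
  where
  open ≤-Reasoning
  P U : ℕ
  P = sum (applyUpTo (p ∘ suc) n)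
  U = units n (p ∘ suc)

≤-<-trans-slope : ∀ p₀ p₁ → p₁ * c ≤ q₁ → p₀ * q₁ < p₁ * q₀ → p₀ * c < q₀
≤-<-trans-slope {c} {q₁} {q₀} p₀ p₁ c≤q₁/p₁ slopes = *-cancelˡ-< p₁ (p₀ * c) q₀ (begin-strict
  p₁ * (p₀ * c)   ≡⟨ x∙yz≈y∙xz p₁ p₀ c ⟩
  p₀ * (p₁ * c)   ≤⟨ *-monoʳ-≤ p₀ c≤q₁/p₁ ⟩
  p₀ * q₁         <⟨ slopes ⟩
  p₁ * q₀         ∎)
  where open ≤-Reasoning

InProgression-above : InProgression a m x → (1 ≤ t → a + (t ∸ 1) * m < x) → a + t * m ≤ x
InProgression-above {a} {t = zero}      (_ , refl) _     = +-monoʳ-≤ a z≤n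
InProgression-above {a} {m} {t = suc r} (t′ , refl) below =
  +-monoʳ-≤ a (*-monoˡ-≤ m (*-cancelʳ-< m r t′ (+-cancelˡ-< a (r * m) (t′ * m) (below (s≤s z≤n)))))

width-one : p₀ ≡ 1 → p₀ * c ≡ c
width-one {c = c} refl = *-identityˡ c

-- Induct from the steep end: the first edge is at least as steep as the steepest
-- unit edge, whose height is at least a + (s − 1)m when s unit edges remain.
mutual
  first-slope-bound : DecreasingSlopes n p q → UnitHeightsIn a m n p q → 1 ≤ units n p →
                      p 0 * (a + (units n p ∸ 1) * m) ≤ q 0
  first-slope-bound {suc n} {p} dec hs 1≤units with p 0 ≟ 1
  ... | yes p₀≡1 rewrite units-accept {p = p} {n = n} p₀≡1 =
    ≤-trans (≤-reflexive (width-one p₀≡1)) (first-unit-height dec hs p₀≡1)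
  ... | no p₀≢1 rewrite units-reject {p = p} {n = n} p₀≢1 = <⇒≤ (steeper-than-tail dec hs 1≤units)

  first-unit-height : DecreasingSlopes (suc n) p q → UnitHeightsIn a m (suc n) p q → p 0 ≡ 1 →
                      a + units n (p ∘ suc) * m ≤ q 0
  first-unit-height {q = q} dec hs p₀≡1 = InProgression-above (hs 0 z<s p₀≡1) λ 1≤units →
    subst (_< q 0) (width-one p₀≡1) (steeper-than-tail dec hs 1≤units)

  steeper-than-tail : DecreasingSlopes (suc n) p q → UnitHeightsIn a m (suc n) p q → 1 ≤ units n (p ∘ suc) →
                      p 0 * (a + (units n (p ∘ suc) ∸ 1) * m) < q 0
  steeper-than-tail {n} {p} {q} dec hs 1≤units = ≤-<-trans-slope (p 0) (p 1)
    (first-slope-bound {p = p ∘ suc} {q = q ∘ suc} (λ k k<n → dec (suc k) (s≤s k<n))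
                       (λ k k<n → hs (suc k) (s≤s k<n)) 1≤units)
    (dec 0 (s≤s (≤-trans 1≤units units≤n)))

unit-heights-bound : DecreasingSlopes n p q → UnitHeightsIn a m n p q →
                     sum (applyDownFrom (λ j → a + j * m) (units n p)) ≤ sum (applyUpTo q n)
unit-heights-bound {zero}  _ _ = z≤n
unit-heights-bound {suc n} {p} {q} dec hs
  with p 0 ≟ 1 | unit-heights-bound {p = p ∘ suc} {q = q ∘ suc}
                   (λ k k<n → dec (suc k) (s≤s k<n)) (λ k k<n → hs (suc k) (s≤s k<n))
... | yes p₀≡1 | ih rewrite units-accept {p = p} {n = n} p₀≡1 = +-mono-≤ (first-unit-height dec hs p₀≡1) ih
... | no p₀≢1  | ih rewrite units-reject {p = p} {n = n} p₀≢1 = ≤-trans ih (m≤n+m _ (q 0))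

progression-sum : ∀ a m s → 2 * sum (applyDownFrom (λ j → a + j * m) s) ≡ (2 * a + (s ∸ 1) * m) * s
progression-sum a m zero    = sym (*-zeroʳ (2 * a + 0))
progression-sum a m (suc s) = begin
  2 * (a + s * m + S)                          ≡⟨ *-distribˡ-+ 2 (a + s * m) S ⟩
  2 * (a + s * m) + 2 * S                      ≡⟨ cong (λ t → 2 * (a + s * m) + t) (progression-sum a m s) ⟩
  2 * (a + s * m) + (2 * a + (s ∸ 1) * m) * s  ≡⟨ add-last-term s ⟩
  (2 * a + s * m) * suc s                      ∎
  where
  open ≡-Reasoning
  S : ℕ
  S = sum (applyDownFrom (λ j → a + j * m) s)
  add-last-term : ∀ s → 2 * (a + s * m) + (2 * a + (s ∸ 1) * m) * s ≡ (2 * a + s * m) * suc s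
  add-last-term zero    = solve (a ∷ [])
  add-last-term (suc r) = identity
    where identity : 2 * (a + suc r * m) + (2 * a + r * m) * suc r ≡ (2 * a + suc r * m) * suc (suc r)
          identity = solve (a ∷ m ∷ r ∷ [])

⊖-split : ∀ u w z → u ⊖ z ≡ (w ⊖ z) ⊕ (u ⊖ w)
⊖-split (u₁ , u₂) (w₁ , w₂) (z₁ , z₂) = cong₂ _,_ (split u₁ w₁ z₁) (split u₂ w₂ z₂)
  where split : ∀ u w z → u ℤ.- z ≡ (w ℤ.- z) ℤ.+ (u ℤ.- w)
        split = solve-∀

⊖-self : ∀ f₁ f₂ u → u ⊖ u ≡ lin f₁ f₂ 0ℤ 0ℤ
⊖-self (f₁₁ , f₁₂) (f₂₁ , f₂₂) (u₁ , u₂) = cong₂ _,_ (cancel u₁ f₁₁ f₂₁) (cancel u₂ f₁₂ f₂₂)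
  where cancel : ∀ u e e′ → u ℤ.- u ≡ 0ℤ ℤ.* e ℤ.+ 0ℤ ℤ.* e′
        cancel = solve-∀

lin-⊕ : ∀ f₁ f₂ i j i′ j′ → lin f₁ f₂ i j ⊕ lin f₁ f₂ i′ j′ ≡ lin f₁ f₂ (i ℤ.+ i′) (j ℤ.+ j′)
lin-⊕ (f₁₁ , f₁₂) (f₂₁ , f₂₂) i j i′ j′ = cong₂ _,_ (distrib i j i′ j′ f₁₁ f₂₁) (distrib i j i′ j′ f₁₂ f₂₂)
  where distrib : ∀ i j i′ j′ e e′ → (i ℤ.* e ℤ.+ j ℤ.* e′) ℤ.+ (i′ ℤ.* e ℤ.+ j′ ℤ.* e′) ≡ (i ℤ.+ i′) ℤ.* e ℤ.+ (j ℤ.+ j′) ℤ.* e′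
        distrib = solve-∀

lin-⊖ : ∀ f₁ f₂ i j i′ j′ → lin f₁ f₂ i j ⊖ lin f₁ f₂ i′ j′ ≡ lin f₁ f₂ (i ℤ.- i′) (j ℤ.- j′)
lin-⊖ (f₁₁ , f₁₂) (f₂₁ , f₂₂) i j i′ j′ = cong₂ _,_ (distrib i j i′ j′ f₁₁ f₂₁) (distrib i j i′ j′ f₁₂ f₂₂)
  where distrib : ∀ i j i′ j′ e e′ → (i ℤ.* e ℤ.+ j ℤ.* e′) ℤ.- (i′ ℤ.* e ℤ.+ j′ ℤ.* e′) ≡ (i ℤ.- i′) ℤ.* e ℤ.+ (j ℤ.- j′) ℤ.* e′
        distrib = solve-∀

lin-shear : ∀ f₁ f₂ α μ i j → lin (f₁ ⊖ α · f₂) (μ · f₂) i j ≡ lin f₁ f₂ i (j ℤ.* μ ℤ.- i ℤ.* α)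
lin-shear (f₁₁ , f₁₂) (f₂₁ , f₂₂) α μ i j = cong₂ _,_ (regroup α μ i j f₁₁ f₂₁) (regroup α μ i j f₁₂ f₂₂)
  where regroup : ∀ α μ i j e e′ → i ℤ.* (e ℤ.- α ℤ.* e′) ℤ.+ j ℤ.* (μ ℤ.* e′) ≡ i ℤ.* e ℤ.+ (j ℤ.* μ ℤ.- i ℤ.* α) ℤ.* e′
        regroup = solve-∀

coordinates-unique : IsBasisℤ² f₁ f₂ → lin f₁ f₂ i j ≡ lin f₁ f₂ i′ j′ → i ≡ i′ × j ≡ j′
coordinates-unique {f₁} {f₂} {i} {j} {i′} {j′} basis same
  with (_ , _ , unique) ← basis (lin f₁ f₂ i j)
  with (i≡ , j≡) ← unique i j refl | (i′≡ , j′≡) ← unique i′ j′ same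
  = trans i≡ (sym i′≡) , trans j≡ (sym j′≡)

telescope : ∀ f₁ f₂ → (∀ k → k < n → v (suc k) ⊖ v k ≡ lin f₁ f₂ (+ p k) (- + q k)) →
            v n ⊖ v 0 ≡ lin f₁ f₂ (+ sum (applyUpTo p n)) (- + sum (applyUpTo q n))
telescope {zero}  {v} f₁ f₂ _ = ⊖-self f₁ f₂ (v 0)
telescope {suc n} {v} {p} {q} f₁ f₂ edge = begin
  v (suc n) ⊖ v 0                                       ≡⟨ ⊖-split (v (suc n)) (v 1) (v 0) ⟩
  (v 1 ⊖ v 0) ⊕ (v (suc n) ⊖ v 1)                       ≡⟨ cong₂ _⊕_ (edge 0 z<s) rest ⟩
  lin f₁ f₂ (+ p 0) (- + q 0) ⊕ lin f₁ f₂ (+ P) (- + Q) ≡⟨ lin-⊕ f₁ f₂ (+ p 0) (- + q 0) (+ P) (- + Q) ⟩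
  lin f₁ f₂ (+ p 0 ℤ.+ + P) (- + q 0 ℤ.+ - + Q)         ≡⟨ cong₂ (lin f₁ f₂) (ℤₚ.pos-+ (p 0) P) neg-sum ⟨
  lin f₁ f₂ (+ (p 0 + P)) (- + (q 0 + Q))               ∎
  where
  open ≡-Reasoning
  P Q : ℕ
  P = sum (applyUpTo (p ∘ suc) n)
  Q = sum (applyUpTo (q ∘ suc) n)
  rest : v (suc n) ⊖ v 1 ≡ lin f₁ f₂ (+ P) (- + Q)
  rest = telescope {v = v ∘ suc} {p ∘ suc} {q ∘ suc} f₁ f₂ λ k k<n → edge (suc k) (s≤s k<n)
  neg-sum : - + (q 0 + Q) ≡ - + q 0 ℤ.+ - + Q
  neg-sum = trans (cong -_ (ℤₚ.pos-+ (q 0) Q)) (ℤₚ.neg-distrib-+ (+ q 0) (+ Q))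

positive-∣∣ : 0ℤ ℤ.< i → + ∣ i ∣ ≡ i × 1 ≤ ∣ i ∣
positive-∣∣ {+[1+ _ ]} _         = refl , s≤s z≤n
positive-∣∣ {+0}       (+<+ ())

negative-∣∣ : i ℤ.< 0ℤ → - + ∣ i ∣ ≡ i × 1 ≤ ∣ i ∣
negative-∣∣ { -[1+ _ ]} _       = refl , s≤s z≤n
negative-∣∣ {+ _}      (+<+ ())

cross-product>0⇒< : ∀ p₀ q₀ p₁ q₁ → 0ℤ ℤ.< + p₀ ℤ.* - + q₁ ℤ.- + p₁ ℤ.* - + q₀ → p₀ * q₁ < p₁ * q₀
cross-product>0⇒< p₀ q₀ p₁ q₁ 0<cross = ℤₚ.drop‿+<+ (begin-strict
  + (p₀ * q₁)                  ≡⟨ ℤₚ.+-identityˡ (+ (p₀ * q₁)) ⟨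
  0ℤ ℤ.+ + (p₀ * q₁)           <⟨ ℤₚ.+-monoˡ-< (+ (p₀ * q₁)) 0<cross ⟩
  cross ℤ.+ + (p₀ * q₁)        ≡⟨ cong (λ t → cross ℤ.+ t) (ℤₚ.pos-* p₀ q₁) ⟩
  cross ℤ.+ + p₀ ℤ.* + q₁      ≡⟨ cancel (+ p₀) (+ q₀) (+ p₁) (+ q₁) ⟩
  + p₁ ℤ.* + q₀                ≡⟨ ℤₚ.pos-* p₁ q₀ ⟨
  + (p₁ * q₀)                  ∎)
  where
  open ℤₚ.≤-Reasoning
  cross : ℤ
  cross = + p₀ ℤ.* - + q₁ ℤ.- + p₁ ℤ.* - + q₀
  cancel : ∀ p₀ q₀ p₁ q₁ → p₀ ℤ.* - q₁ ℤ.- p₁ ℤ.* - q₀ ℤ.+ p₀ ℤ.* q₁ ≡ p₁ ℤ.* q₀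
  cancel = solve-∀

record SlopeEdges (f₁ f₂ : V) (n : ℕ) (v : ℕ → V) : Set where
  field
    width height : ℕ → ℕ
    edge         : ∀ k → k < n → v (suc k) ⊖ v k ≡ lin f₁ f₂ (+ width k) (- + height k)
    width-pos    : ∀ k → k < n → 1 ≤ width k
    height-pos   : ∀ k → k < n → 1 ≤ height k
    convex       : DecreasingSlopes n width height

integer-slope-edges : IsIntegerSlope f₁ f₂ n v → SlopeEdges f₁ f₂ n v
integer-slope-edges {f₁} {f₂} {n} {v} (a , edges , det>0) = record
  { width      = width
  ; height     = height
  ; edge       = λ k k<n → trans (proj₁ (edges (suc k) (s≤s z≤n) k<n))
                                 (sym (cong₂ (lin f₁ f₂) (proj₁ (α-pos k k<n)) (proj₁ (β-neg k k<n))))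
  ; width-pos  = λ k k<n → proj₂ (α-pos k k<n)
  ; height-pos = λ k k<n → proj₂ (β-neg k k<n)
  ; convex     = λ k 1+k<n → cross-product>0⇒< (width k) (height k) (width (suc k)) (height (suc k))
      (subst₂ (λ i j → 0ℤ ℤ.< i ℤ.- j)
              (sym (cong₂ ℤ._*_ (proj₁ (α-pos k (<⇒≤ 1+k<n))) (proj₁ (β-neg (suc k) 1+k<n))))
              (sym (cong₂ ℤ._*_ (proj₁ (α-pos (suc k) 1+k<n)) (proj₁ (β-neg k (<⇒≤ 1+k<n)))))
              (det>0 (suc k) (s≤s z≤n) 1+k<n))
  }
  where
  α β : ℕ → ℤ
  α k = proj₁ (a (suc k))
  β k = proj₂ (a (suc k))
  width height : ℕ → ℕ
  width k  = ∣ α k ∣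
  height k = ∣ β k ∣
  α-pos : ∀ k → k < n → + width k ≡ α k × 1 ≤ width k
  α-pos k k<n = positive-∣∣ (proj₁ (proj₂ (edges (suc k) (s≤s z≤n) k<n)))
  β-neg : ∀ k → k < n → - + height k ≡ β k × 1 ≤ height k
  β-neg k k<n = negative-∣∣ (proj₂ (proj₂ (edges (suc k) (s≤s z≤n) k<n)))

InLattice-⊖ : InLattice c₁ c₂ u → InLattice c₁ c₂ w → InLattice c₁ c₂ (u ⊖ w)
InLattice-⊖ {c₁} {c₂} (i , j , refl) (i′ , j′ , refl) = i ℤ.- i′ , j ℤ.- j′ , lin-⊖ c₁ c₂ i j i′ j′

edge-in-lattice : (∀ i → i ≤ n → InLattice c₁ c₂ (v i)) → ∀ k → k < n → InLattice c₁ c₂ (v (suc k) ⊖ v k)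
edge-in-lattice vertices k k<n = InLattice-⊖ (vertices (suc k) k<n) (vertices k (<⇒≤ k<n))

small-step-∣ : IsSmallStep f₁ f₂ c₁ c₂ d → InLattice c₁ c₂ (lin f₁ f₂ i j) → d ∣ℤ i
small-step-∣ {i = i} {j} (_ , step) inΛ = Equivalence.to (step i) (j , inΛ)

>1⇒∤1 : 1ℤ ℤ.< d → ¬ d ∣ℤ 1ℤ
>1⇒∤1 {+ _} (+<+ 1<d) d∣1 = <-irrefl (sym (ℕ.∣1⇒≡1 d∣1)) 1<d

positive-progression-member : a ≤ m → 1 ≤ x → + x ≡ + a ℤ.+ i ℤ.* + m → InProgression a m x
positive-progression-member {a} {m} {x} {+ t} _ _ x≡ = t , ℤₚ.+-injective (begin
  + x                   ≡⟨ x≡ ⟩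
  + a ℤ.+ + t ℤ.* + m   ≡⟨ cong (λ k → + a ℤ.+ k) (ℤₚ.pos-* t m) ⟨
  + a ℤ.+ + (t * m)     ≡⟨ ℤₚ.pos-+ a (t * m) ⟨
  + (a + t * m)         ∎)
  where open ≡-Reasoning
positive-progression-member {a} {m} {x} { -[1+ t ]} a≤m 1≤x x≡ =
  contradiction (≤-trans 1≤x (ℤₚ.drop‿+≤+ x≤0)) λ ()
  where
  open ℤₚ.≤-Reasoning
  x≤0 : + x ℤ.≤ 0ℤ
  x≤0 = begin
    + x                          ≡⟨ x≡ ⟩
    + a ℤ.+ -[1+ t ] ℤ.* + m     ≡⟨ cong (λ k → + a ℤ.+ k) (ℤₚ.neg-distribˡ-* (+ suc t) (+ m)) ⟨
    + a ℤ.+ - (+ suc t ℤ.* + m)  ≡⟨ cong (λ k → + a ℤ.+ - k) (ℤₚ.pos-* (suc t) m) ⟨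
    + a ℤ.+ - + (suc t * m)      ≡⟨ ℤₚ.m-n≡m⊖n a (suc t * m) ⟩
    a ℤ.⊖ (suc t * m)            ≡⟨ ℤₚ.⊖-≤ (≤-trans a≤m (m≤m+n m (t * m))) ⟩
    - + (suc t * m ∸ a)          ≤⟨ ℤₚ.neg-≤-pos ⟩
    0ℤ                           ∎

shear-unit-height : IsBasisℤ² f₁ f₂ → a ≤ m → 1 ≤ x →
                    InLattice (f₁ ⊖ (+ a) · f₂) ((+ m) · f₂) (lin f₁ f₂ 1ℤ (- + x)) → InProgression a m x
shear-unit-height {f₁} {f₂} {a} {m} {x} basis a≤m 1≤x (i , j , edge≡) =
  positive-progression-member {i = - j} a≤m 1≤x (begin
    + x                          ≡⟨ ℤₚ.neg-involutive (+ x) ⟨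
    - - + x                      ≡⟨ cong -_ (proj₂ coordinates) ⟩
    - (j ℤ.* + m ℤ.- i ℤ.* + a)  ≡⟨ cong (λ k → - (j ℤ.* + m ℤ.- k ℤ.* + a)) (proj₁ coordinates) ⟨
    - (j ℤ.* + m ℤ.- 1ℤ ℤ.* + a) ≡⟨ negate j (+ m) (+ a) ⟩
    + a ℤ.+ - j ℤ.* + m          ∎)
  where
  open ≡-Reasoning
  coordinates : 1ℤ ≡ i × - + x ≡ j ℤ.* + m ℤ.- i ℤ.* + a
  coordinates = coordinates-unique basis (trans edge≡ (lin-shear f₁ f₂ (+ a) (+ m) i j))
  negate : ∀ j μ α → - (j ℤ.* μ ℤ.- 1ℤ ℤ.* α) ≡ α ℤ.+ (- j) ℤ.* μ
  negate = solve-∀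

module _ (E : SlopeEdges f₁ f₂ n v) where
  open SlopeEdges E

  displacement-coordinates : IsBasisℤ² f₁ f₂ → v n ⊖ v 0 ≡ lin f₁ f₂ i j →
                             ∣ i ∣ ≡ sum (applyUpTo width n) × ∣ j ∣ ≡ sum (applyUpTo height n)
  displacement-coordinates {i = i} {j} basis displacement
    with refl , refl ← coordinates-unique {i = i} {j} {+ sum (applyUpTo width n)} { - + sum (applyUpTo height n)}
                         basis (trans (sym displacement) (telescope {v = v} f₁ f₂ edge))
    = refl , ℤₚ.∣-i∣≡∣i∣ (+ sum (applyUpTo height n))

  edge-in : (∀ i → i ≤ n → InLattice c₁ c₂ (v i)) →
            ∀ k → k < n → InLattice c₁ c₂ (lin f₁ f₂ (+ width k) (- + height k))
  edge-in vertices k k<n = subst (InLattice _ _) (edge k k<n) (edge-in-lattice vertices k k<n)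

  small-step-no-unit-widths : (∀ i → i ≤ n → InLattice c₁ c₂ (v i)) → IsSmallStep f₁ f₂ c₁ c₂ d → 1ℤ ℤ.< d →
                              ∀ k → k < n → width k ≢ 1
  small-step-no-unit-widths {d = d} vertices step 1<d k k<n width≡1 = >1⇒∤1 1<d (subst (λ w → d ∣ℤ + w) width≡1
    (small-step-∣ {i = + width k} { - + height k} step (edge-in vertices k k<n)))

  shear-unit-heights : IsBasisℤ² f₁ f₂ → a ≤ m →
                       (∀ i → i ≤ n → InLattice (f₁ ⊖ (+ a) · f₂) ((+ m) · f₂) (v i)) →
                       UnitHeightsIn a m n width height
  shear-unit-heights basis a≤m vertices k k<n width≡1 = shear-unit-height basis a≤m (height-pos k k<n)
    (subst (λ w → InLattice _ _ (lin f₁ f₂ (+ w) (- + height k))) width≡1 (edge-in vertices k k<n))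

triangular : ∀ s → (2 * 1 + (s ∸ 1) * 1) * s ≡ s * (s + 1)
triangular zero    = refl
triangular (suc s) = identity
  where identity : (2 * 1 + s * 1) * suc s ≡ suc s * (suc s + 1)
        identity = solve (s ∷ [])

InProgression-1-1 : 1 ≤ x → InProgression 1 1 x
InProgression-1-1 {suc t} _ = t , cong suc (sym (*-identityʳ t))

proposition3p2 : (f₁ f₂ : V) → IsBasisℤ² f₁ f₂ →
    (N : ℕ) (v : ℕ → V) → IsIntegerSlope f₁ f₂ N v →
    (b₁ b₂ : ℤ) → v N ⊖ v 0 ≡ lin f₁ f₂ b₁ b₂ →
    (∃[ s ] ((2 * N ≤ ∣ b₁ ∣ + s) × (s * (s + 1) ≤ 2 * ∣ b₂ ∣) × (s ≤ N)))
    × ((c₁ c₂ : V) → det c₁ c₂ ≢ 0ℤ →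
        ((i : ℕ) → i ≤ N → InLattice c₁ c₂ (v i)) →
        (d : ℤ) → IsSmallStep f₁ f₂ c₁ c₂ d → 1ℤ ℤ.< d →
        2 * N ≤ ∣ b₁ ∣)
    × ((a m : ℕ) → 1 ≤ a → a ≤ m →
        ((i : ℕ) → i ≤ N →
          InLattice (f₁ ⊖ (+ a) · f₂) ((+ m) · f₂) (v i)) →
        ∃[ s ] ((2 * N ≤ ∣ b₁ ∣ + s)
               × ((2 * a + (s ∸ 1) * m) * s ≤ 2 * ∣ b₂ ∣)
               × (s ≤ N)))
proposition3p2 f₁ f₂ basis N v slope b₁ b₂ displacement =
    (s , widths , subst (_≤ 2 * ∣ b₂ ∣) (triangular s) (heights λ k k<N _ → InProgression-1-1 (height-pos k k<N))
       , units≤n)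
  , (λ c₁ c₂ _ vertices d step 1<d →
       subst (2 * N ≤_) (+-identityʳ ∣ b₁ ∣)
         (subst (λ u → 2 * N ≤ ∣ b₁ ∣ + u) (units≡0 (small-step-no-unit-widths E vertices step 1<d)) widths))
  , (λ a m _ a≤m vertices → s , widths , heights (shear-unit-heights E basis a≤m vertices) , units≤n)
  where
  E : SlopeEdges f₁ f₂ N v
  E = integer-slope-edges slope
  open SlopeEdges E
  s : ℕ
  s = units N width
  b-sums : ∣ b₁ ∣ ≡ sum (applyUpTo width N) × ∣ b₂ ∣ ≡ sum (applyUpTo height N)
  b-sums = displacement-coordinates E {i = b₁} {b₂} basis displacement
  widths : 2 * N ≤ ∣ b₁ ∣ + s
  widths = subst (λ w → 2 * N ≤ w + s) (sym (proj₁ b-sums)) (widths-bound width-pos)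
  heights : ∀ {a m} → UnitHeightsIn a m N width height → (2 * a + (s ∸ 1) * m) * s ≤ 2 * ∣ b₂ ∣
  heights {a} {m} hs = subst₂ _≤_ (progression-sum a m s) (cong (2 *_) (sym (proj₂ b-sums)))
                              (*-monoʳ-≤ 2 (unit-heights-bound convex hs))
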